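{- Let $n\ge1$, let $\pi$ be a permutation of $[n]$ and let $\beta$ be a prefix block-interchange. Then $|b(\pi\beta)-b(\pi)|\le 3$.
   Context: Permutations of $[n]=\{1,\dots,n\}$ are written as sequences $\pi=\langle\pi_1\,\pi_2\cdots\pi_n\rangle$ with $\pi_i=\pi(i)$; products are compositions applied right to left, so $(\pi\sigma)_i=\pi_{\sigma(i)}$. For $1\le i<j\le k<\ell\le n+1$, the block-interchange $\beta(i,j,k,\ell)$ is the permutation $\langle 1\cdots i-1\;\; k\cdots \ell-1\;\; j\cdots k-1\;\; i\cdots j-1\;\; \ell\cdots n\rangle$, so that $\pi\beta(i,j,k,\ell)$ is obtained from $\pi$ by exchanging the blocks $\pi_i\cdots\pi_{j-1}$ and $\pi_k\cdots\pi_{\ell-1}$. A prefix block-interchange is a block-interchange with $i=1$. Breakpoints: extend $\pi$ to $\langle \pi_0\,\pi_1\cdots\pi_n\,\pi_{n+1}\rangle$ with $\pi_0=0$, $\pi_{n+1}=n+1$; for $0\le i\le n$ the pair $(\pi_i,\pi_{i+1})$ is a breakpoint if $i=0$ or $\pi_{i+1}-\pi_i\neq1$. $b(\pi)$ is the number of breakpoints. -}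

module Defs where

open import Data.Nat using (ℕ; zero; suc; _+_; _∸_; _<_; _<?_; _≟_)
open import Data.Fin using (Fin; toℕ; fromℕ<)
open import Data.Fin.Permutation using (Permutation′; _⟨$⟩ʳ_)
open import Relation.Nullary using (yes; no)

-- A sequence of length n is given 1-indexed as a function s : ℕ → ℕ
-- (only positions 1..n are relevant).

-- The one-line notation of a permutation π of [n] = {1,…,n}:
-- π is a bijection Fin n → Fin n, with value (1 + toℕ (π (p-1))) at position p.
seq : {n : ℕ} → Permutation′ n → ℕ → ℕ
seq {n} π zero = 0
seq {n} π (suc p) with p <? n
... | yes p<n = suc (toℕ (π ⟨$⟩ʳ fromℕ< p<n))
... | no _ = 0

-- Block-interchange β(i,j,k,ℓ) as a map on positions:
-- ⟨1 ⋯ i-1, k ⋯ ℓ-1, j ⋯ k-1, i ⋯ j-1, ℓ ⋯ n⟩ ; i.e. β(p) is the p-th entry.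
blockInterchange : ℕ → ℕ → ℕ → ℕ → ℕ → ℕ
blockInterchange i j k ℓ p with p <? i
... | yes _ = p
... | no _ with p <? i + (ℓ ∸ k)
...   | yes _ = k + (p ∸ i)
...   | no _ with p <? i + (ℓ ∸ k) + (k ∸ j)
...     | yes _ = j + (p ∸ (i + (ℓ ∸ k)))
...     | no _ with p <? ℓ
...       | yes _ = i + (p ∸ (i + (ℓ ∸ k) + (k ∸ j)))
...       | no _ = p

_·_ : (ℕ → ℕ) → (ℕ → ℕ) → ℕ → ℕ
(s · σ) p = s (σ p)

ext : ℕ → (ℕ → ℕ) → ℕ → ℕ
ext n s zero = 0
ext n s (suc p) with p <? n
... | yes _ = s (suc p)
... | no _ = suc n

isBreak : ℕ → (ℕ → ℕ) → ℕ → ℕ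
isBreak n s zero = 1
isBreak n s (suc i) with ext n s (suc (suc i)) ≟ suc (ext n s (suc i))
... | yes _ = 0
... | no _ = 1

countBreaks : ℕ → (ℕ → ℕ) → ℕ → ℕ
countBreaks n s zero = 0
countBreaks n s (suc m) = countBreaks n s m + isBreak n s m

b : ℕ → (ℕ → ℕ) → ℕ
b n s = countBreaks n s (suc n)

module Submission where

-- Write the prefix block-interchange as swapping the blocks
-- A = π₁⋯π_a and C = π_{a+b′+1}⋯π_{a+b′+c} around B = π_{a+1}⋯π_{a+b′},
-- leaving the tail T of length d fixed.  The breakpoints of a sequence split
-- into the breakpoint at position 0 plus the breakpoints of consecutive
-- windows, one window per block.  A block is copied verbatim, so every pair
-- of adjacent entries inside it is a breakpoint before the move iff it is one
-- after; only the pair joining a block to its successor can change.  Hence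
-- each of the windows of A, B, C changes its count by at most one and the
-- window of T does not change at all, which gives |b(πβ) − b(π)| ≤ 3.
-- Nothing about permutations is used: the bound holds for every sequence.

open import Defs
open import Data.Nat using (ℕ; suc; zero; _≤_; _<_; _+_; _∸_; z≤n; s≤s; _<?_; _≟_)
open import Data.Nat.Properties
open import Data.Integer using (+_; _-_; ∣_∣)
import Data.Integer.Properties as ℤ
open import Data.Fin.Permutation using (Permutation′)
open import Data.Product using (_×_; _,_; proj₂)
open import Relation.Binary.PropositionalEquality
open import Relation.Nullary using (yes; no)
open import Relation.Nullary.Negation using (contradiction)
open import Relation.Nullary.Decidable using (dec-yes; dec-no)
open import Algebra.Properties.CommutativeSemigroup +-commutativeSemigroup
  using (interchange; xy∙z≈zy∙x)
open import Data.Nat.Tactic.RingSolver using (solve-∀)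

Near : ℕ → ℕ → ℕ → Set
Near k x y = x ≤ y + k × y ≤ x + k

near-≡ : ∀ {x y} → x ≡ y → Near 0 x y
near-≡ {x} refl = m≤m+n x 0 , m≤m+n x 0

near-+ : ∀ {k m x y x′ y′} → Near k x y → Near m x′ y′ → Near (k + m) (x + x′) (y + y′)
near-+ {k} {m} {x} {y} {x′} {y′} (x≤ , y≤) (x′≤ , y′≤) =
  ≤-trans (+-mono-≤ x≤ x′≤) (≤-reflexive (interchange y k y′ m)) ,
  ≤-trans (+-mono-≤ y≤ y′≤) (≤-reflexive (interchange x k x′ m))

near-suc : ∀ {k x y} → Near k x y → Near k (suc x) (suc y)
near-suc (x≤ , y≤) = s≤s x≤ , s≤s y≤

near⇒∣-∣≤ : ∀ {k x y} → Near k x y → ∣ + x - + y ∣ ≤ k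
near⇒∣-∣≤ {k} {x} {y} (x≤ , y≤) rewrite ℤ.[+m]-[+n]≡m⊖n x y with y ≤? x
... | yes y≤x rewrite ℤ.⊖-≥ y≤x =
  ≤-trans (∸-monoˡ-≤ y x≤) (≤-reflexive (m+n∸m≡n y k))
... | no y≰x rewrite ℤ.⊖-< (≰⇒> y≰x) | ℤ.∣-i∣≡∣i∣ (+ (y ∸ x)) =
  ≤-trans (∸-monoˡ-≤ x y≤) (≤-reflexive (m+n∸m≡n x k))

-- The position map β = blockInterchange i j k ℓ on its four regions: after
-- the first i-1 positions come the block [k,ℓ), then [j,k), then [i,j),
-- occupying [i,b₁), [b₁,b₂), [b₂,ℓ) with b₁ = i+(ℓ-k), b₂ = b₁+(k-j).
module Regions (i j k ℓ : ℕ) {p : ℕ} where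

  bi-moved-last : i ≤ p → p < i + (ℓ ∸ k) → blockInterchange i j k ℓ p ≡ k + (p ∸ i)
  bi-moved-last i≤p p<b₁
    rewrite dec-no (p <? i) (≤⇒≯ i≤p)
          | proj₂ (dec-yes (p <? i + (ℓ ∸ k)) p<b₁) = refl

  bi-middle : i + (ℓ ∸ k) ≤ p → p < i + (ℓ ∸ k) + (k ∸ j) →
    blockInterchange i j k ℓ p ≡ j + (p ∸ (i + (ℓ ∸ k)))
  bi-middle b₁≤p p<b₂
    rewrite dec-no (p <? i) (≤⇒≯ (≤-trans (m≤m+n i (ℓ ∸ k)) b₁≤p))
          | dec-no (p <? i + (ℓ ∸ k)) (≤⇒≯ b₁≤p)
          | proj₂ (dec-yes (p <? i + (ℓ ∸ k) + (k ∸ j)) p<b₂) = refl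

  bi-moved-first : i + (ℓ ∸ k) + (k ∸ j) ≤ p → p < ℓ →
    blockInterchange i j k ℓ p ≡ i + (p ∸ (i + (ℓ ∸ k) + (k ∸ j)))
  bi-moved-first b₂≤p p<ℓ
    rewrite dec-no (p <? i) (≤⇒≯ (≤-trans (m≤m+n i _) (≤-trans (m≤m+n _ (k ∸ j)) b₂≤p)))
          | dec-no (p <? i + (ℓ ∸ k)) (≤⇒≯ (≤-trans (m≤m+n _ (k ∸ j)) b₂≤p))
          | dec-no (p <? i + (ℓ ∸ k) + (k ∸ j)) (≤⇒≯ b₂≤p)
          | proj₂ (dec-yes (p <? ℓ) p<ℓ) = refl

  bi-after : i + (ℓ ∸ k) + (k ∸ j) ≤ p → ℓ ≤ p → blockInterchange i j k ℓ p ≡ p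
  bi-after b₂≤p ℓ≤p
    rewrite dec-no (p <? i) (≤⇒≯ (≤-trans (m≤m+n i _) (≤-trans (m≤m+n _ (k ∸ j)) b₂≤p)))
          | dec-no (p <? i + (ℓ ∸ k)) (≤⇒≯ (≤-trans (m≤m+n _ (k ∸ j)) b₂≤p))
          | dec-no (p <? i + (ℓ ∸ k) + (k ∸ j)) (≤⇒≯ b₂≤p)
          | dec-no (p <? ℓ) (≤⇒≯ ℓ≤p) = refl

reverse-blocks : ∀ i x y z → i + x + y + z ≡ i + z + y + x
reverse-blocks = solve-∀

module Blocks (i a b′ c : ℕ) where

  β : ℕ → ℕ
  β = blockInterchange i (i + a) (i + a + b′) (i + a + b′ + c)

  open Regions i (i + a) (i + a + b′) (i + a + b′ + c)

  private
    b₁≡ : i + (i + a + b′ + c ∸ (i + a + b′)) ≡ i + c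
    b₁≡ = cong (λ m → i + m) (m+n∸m≡n (i + a + b′) c)

    b₂≡ : i + (i + a + b′ + c ∸ (i + a + b′)) + (i + a + b′ ∸ (i + a)) ≡ i + c + b′
    b₂≡ = cong₂ _+_ b₁≡ (m+n∸m≡n (i + a) b′)

    ℓ≡ : i + c + b′ + a ≡ i + a + b′ + c
    ℓ≡ = reverse-blocks i c b′ a

  β-C : ∀ t → t < c → β (i + t) ≡ i + a + b′ + t
  β-C t t<c = trans
    (bi-moved-last (m≤m+n i t) (subst (i + t <_) (sym b₁≡) (+-monoʳ-< i t<c)))
    (cong (λ m → i + a + b′ + m) (m+n∸m≡n i t))

  β-B : ∀ t → t < b′ → β (i + c + t) ≡ i + a + t
  β-B t t<b′ = begin
    β (i + c + t)
      ≡⟨ bi-middle (subst (_≤ i + c + t) (sym b₁≡) (m≤m+n (i + c) t))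
                   (subst (i + c + t <_) (sym b₂≡) (+-monoʳ-< (i + c) t<b′)) ⟩
    i + a + (i + c + t ∸ (i + (i + a + b′ + c ∸ (i + a + b′))))
      ≡⟨ cong (λ m → i + a + (i + c + t ∸ m)) b₁≡ ⟩
    i + a + (i + c + t ∸ (i + c))
      ≡⟨ cong (λ m → i + a + m) (m+n∸m≡n (i + c) t) ⟩
    i + a + t ∎
    where open ≡-Reasoning

  β-A : ∀ t → t < a → β (i + c + b′ + t) ≡ i + t
  β-A t t<a = begin
    β (i + c + b′ + t)
      ≡⟨ bi-moved-first (subst (_≤ i + c + b′ + t) (sym b₂≡) (m≤m+n (i + c + b′) t))
                        (subst (i + c + b′ + t <_) ℓ≡ (+-monoʳ-< (i + c + b′) t<a)) ⟩
    i + (i + c + b′ + t ∸ (i + (i + a + b′ + c ∸ (i + a + b′)) + (i + a + b′ ∸ (i + a))))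
      ≡⟨ cong (λ m → i + (i + c + b′ + t ∸ m)) b₂≡ ⟩
    i + (i + c + b′ + t ∸ (i + c + b′))
      ≡⟨ cong (λ m → i + m) (m+n∸m≡n (i + c + b′) t) ⟩
    i + t ∎
    where open ≡-Reasoning

  β-tail : ∀ p → i + a + b′ + c ≤ p → β p ≡ p
  β-tail p ℓ≤p = bi-after (subst (_≤ p) (sym b₂≡) (≤-trans (≤-trans (m≤m+n _ a) (≤-reflexive ℓ≡)) ℓ≤p)) ℓ≤p

breaksIn : ℕ → (ℕ → ℕ) → ℕ → ℕ → ℕ
breaksIn n s x zero = 0
breaksIn n s x (suc l) = breaksIn n s x l + isBreak n s (x + l)

b≡1+breaksIn : ∀ n s m → countBreaks n s (suc m) ≡ suc (breaksIn n s 1 m)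
b≡1+breaksIn n s zero = refl
b≡1+breaksIn n s (suc m) = cong (_+ isBreak n s (suc m)) (b≡1+breaksIn n s m)

breaksIn-++ : ∀ n s x l l′ → breaksIn n s x (l + l′) ≡ breaksIn n s x l + breaksIn n s (x + l) l′
breaksIn-++ n s x l zero rewrite +-identityʳ l = sym (+-identityʳ _)
breaksIn-++ n s x l (suc l′) rewrite +-suc l l′ | breaksIn-++ n s x l l′ | +-assoc x l l′ =
  +-assoc (breaksIn n s x l) (breaksIn n s (x + l) l′) (isBreak n s (x + (l + l′)))

breaksIn-split₄ : ∀ n s p q r d → breaksIn n s 1 (p + q + r + d) ≡
  breaksIn n s 1 p + breaksIn n s (1 + p) q + breaksIn n s (1 + p + q) r
    + breaksIn n s (1 + (p + q + r)) d
breaksIn-split₄ n s p q r d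
  rewrite breaksIn-++ n s 1 (p + q + r) d | breaksIn-++ n s 1 (p + q) r
        | breaksIn-++ n s 1 p q = refl

isBreak≤1 : ∀ n s q → isBreak n s q ≤ 1
isBreak≤1 n s zero = ≤-refl
isBreak≤1 n s (suc q) with ext n s (suc (suc q)) ≟ suc (ext n s (suc q))
... | yes _ = z≤n
... | no _ = ≤-refl

breaksIn-cong : ∀ n s s′ x y l → (∀ t → t < l → isBreak n s (x + t) ≡ isBreak n s′ (y + t)) →
  breaksIn n s x l ≡ breaksIn n s′ y l
breaksIn-cong n s s′ x y zero agree = refl
breaksIn-cong n s s′ x y (suc l) agree =
  cong₂ _+_ (breaksIn-cong n s s′ x y l (λ t t<l → agree t (m<n⇒m<1+n t<l))) (agree l ≤-refl)

breaksIn-≤-last : ∀ n s s′ x y l → (∀ t → suc t < l → isBreak n s (x + t) ≡ isBreak n s′ (y + t)) →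
  breaksIn n s x l ≤ breaksIn n s′ y l + 1
breaksIn-≤-last n s s′ x y zero agree = z≤n
breaksIn-≤-last n s s′ x y (suc l) agree = begin
  breaksIn n s x l + isBreak n s (x + l)
    ≡⟨ cong (_+ isBreak n s (x + l)) (breaksIn-cong n s s′ x y l (λ t t<l → agree t (s≤s t<l))) ⟩
  breaksIn n s′ y l + isBreak n s (x + l)
    ≤⟨ +-monoʳ-≤ (breaksIn n s′ y l) (isBreak≤1 n s (x + l)) ⟩
  breaksIn n s′ y l + 1
    ≤⟨ +-monoˡ-≤ 1 (m≤m+n (breaksIn n s′ y l) (isBreak n s′ (y + l))) ⟩
  breaksIn n s′ y l + isBreak n s′ (y + l) + 1 ∎
  where open ≤-Reasoning

isBreak-cong : ∀ n s s′ q q′ → ext n s (suc q) ≡ ext n s′ (suc q′) →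
  ext n s (suc (suc q)) ≡ ext n s′ (suc (suc q′)) → isBreak n s (suc q) ≡ isBreak n s′ (suc q′)
isBreak-cong n s s′ q q′ e₁ e₂ with ext n s (suc (suc q)) ≟ suc (ext n s (suc q))
                                  | ext n s′ (suc (suc q′)) ≟ suc (ext n s′ (suc q′))
... | yes _ | yes _ = refl
... | no _  | no _  = refl
... | yes adj | no ¬adj = contradiction (trans (sym e₂) (trans adj (cong suc e₁))) ¬adj
... | no ¬adj | yes adj = contradiction (trans e₂ (trans adj (cong suc (sym e₁)))) ¬adj

ext-inside : ∀ n s q → q < n → ext n s (suc q) ≡ s (suc q)
ext-inside n s q q<n with q <? n
... | yes _ = refl
... | no q≮n = contradiction q<n q≮n

ext-cong : ∀ n s s′ q → s (suc q) ≡ s′ (suc q) → ext n s (suc q) ≡ ext n s′ (suc q)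
ext-cong n s s′ q e with q <? n
... | yes _ = e
... | no _ = refl

-- A copied block: if s reads on positions x+1, …, x+l what s′ reads on
-- y+1, …, y+l (all inside 1..n), only the window's last breakpoint can differ.
copied-block : ∀ n s s′ x y l → x + l ≤ n → y + l ≤ n →
  (∀ t → t < l → s (suc (x + t)) ≡ s′ (suc (y + t))) →
  Near 1 (breaksIn n s (suc x) l) (breaksIn n s′ (suc y) l)
copied-block n s s′ x y l x+l≤n y+l≤n same =
  breaksIn-≤-last n s s′ (suc x) (suc y) l agree ,
  breaksIn-≤-last n s′ s (suc y) (suc x) l (λ t st<l → sym (agree t st<l))
  where
  inside : ∀ z t → t < l → z + l ≤ n → z + t < n
  inside z t t<l z+l≤n = ≤-trans (+-monoʳ-< z t<l) z+l≤n

  ext-same : ∀ t → t < l → ext n s (suc (x + t)) ≡ ext n s′ (suc (y + t))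
  ext-same t t<l = begin
    ext n s (suc (x + t))  ≡⟨ ext-inside n s (x + t) (inside x t t<l x+l≤n) ⟩
    s (suc (x + t))        ≡⟨ same t t<l ⟩
    s′ (suc (y + t))       ≡⟨ ext-inside n s′ (y + t) (inside y t t<l y+l≤n) ⟨
    ext n s′ (suc (y + t)) ∎
    where open ≡-Reasoning

  agree : ∀ t → suc t < l → isBreak n s (suc x + t) ≡ isBreak n s′ (suc y + t)
  agree t st<l = isBreak-cong n s s′ (x + t) (y + t) (ext-same t (<⇒≤ st<l))
    (subst₂ (λ u v → ext n s (suc u) ≡ ext n s′ (suc v)) (+-suc x t) (+-suc y t)
      (ext-same (suc t) st<l))

common-tail : ∀ n s s′ m l → (∀ p → m ≤ p → s (suc p) ≡ s′ (suc p)) →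
  breaksIn n s (suc m) l ≡ breaksIn n s′ (suc m) l
common-tail n s s′ m l same = breaksIn-cong n s s′ (suc m) (suc m) l λ t _ →
  isBreak-cong n s s′ (m + t) (m + t)
    (ext-cong n s s′ (m + t) (same (m + t) (m≤m+n m t)))
    (ext-cong n s s′ (suc (m + t)) (same (suc (m + t)) (m≤n⇒m≤1+n (m≤m+n m t))))

module PrefixInterchange (a b′ c d : ℕ) (s : ℕ → ℕ) where
  open Blocks 1 a b′ c

  n : ℕ
  n = a + b′ + c + d

  σ : ℕ → ℕ
  σ = s · β

  Cₛ Bₛ Aₛ Tₛ Cσ Bσ Aσ Tσ : ℕ
  Aₛ = breaksIn n s 1 a
  Bₛ = breaksIn n s (1 + a) b′
  Cₛ = breaksIn n s (1 + a + b′) c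
  Tₛ = breaksIn n s (1 + (a + b′ + c)) d
  Cσ = breaksIn n σ 1 c
  Bσ = breaksIn n σ (1 + c) b′
  Aσ = breaksIn n σ (1 + c + b′) a
  Tσ = breaksIn n σ (1 + (c + b′ + a)) d

  reversed : c + b′ + a ≡ a + b′ + c
  reversed = xy∙z≈zy∙x c b′ a

  blocks-fit-s : a + b′ + c ≤ n
  blocks-fit-s = m≤m+n (a + b′ + c) d

  blocks-fit-σ : c + b′ + a ≤ n
  blocks-fit-σ = subst (_≤ n) (sym reversed) blocks-fit-s

  b-s : b n s ≡ suc (Cₛ + Bₛ + Aₛ + Tₛ)
  b-s = begin
    b n s                        ≡⟨ b≡1+breaksIn n s n ⟩
    suc (breaksIn n s 1 n)       ≡⟨ cong suc (breaksIn-split₄ n s a b′ c d) ⟩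
    suc (Aₛ + Bₛ + Cₛ + Tₛ)      ≡⟨ cong (λ m → suc (m + Tₛ)) (xy∙z≈zy∙x Aₛ Bₛ Cₛ) ⟩
    suc (Cₛ + Bₛ + Aₛ + Tₛ)      ∎
    where open ≡-Reasoning

  b-σ : b n σ ≡ suc (Cσ + Bσ + Aσ + Tσ)
  b-σ = begin
    b n σ                                ≡⟨ b≡1+breaksIn n σ n ⟩
    suc (breaksIn n σ 1 n)               ≡⟨ cong (λ m → suc (breaksIn n σ 1 (m + d))) reversed ⟨
    suc (breaksIn n σ 1 (c + b′ + a + d)) ≡⟨ cong suc (breaksIn-split₄ n σ c b′ a d) ⟩
    suc (Cσ + Bσ + Aσ + Tσ)              ∎
    where open ≡-Reasoning

  C-near : Near 1 Cσ Cₛ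
  C-near = copied-block n σ s 0 (a + b′) c
    (m+n≤o⇒m≤o c (m+n≤o⇒m≤o (c + b′) blocks-fit-σ)) blocks-fit-s
    (λ t t<c → cong s (β-C t t<c))

  B-near : Near 1 Bσ Bₛ
  B-near = copied-block n σ s c a b′
    (m+n≤o⇒m≤o (c + b′) blocks-fit-σ) (m+n≤o⇒m≤o (a + b′) blocks-fit-s)
    (λ t t<b′ → cong s (β-B t t<b′))

  A-near : Near 1 Aσ Aₛ
  A-near = copied-block n σ s (c + b′) 0 a
    blocks-fit-σ (m+n≤o⇒m≤o a (m+n≤o⇒m≤o (a + b′) blocks-fit-s))
    (λ t t<a → cong s (β-A t t<a))

  T-same : Near 0 Tσ Tₛ
  T-same = near-≡ (trans
    (common-tail n σ s (c + b′ + a) d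
      (λ p h → cong s (β-tail (suc p) (s≤s (subst (_≤ p) reversed h)))))
    (cong (λ m → breaksIn n s (suc m) d) reversed))

  breakpoint-bound : Near 3 (b n σ) (b n s)
  breakpoint-bound = subst₂ (Near 3) (sym b-σ) (sym b-s)
    (near-suc (near-+ (near-+ (near-+ C-near B-near) A-near) T-same))

-- Writing j = 1+a, k = j+b′, ℓ = k+c and n+1 = ℓ+d, the theorem is the
-- sequence bound above applied to the one-line notation of π.
lemma5p2 : (n : ℕ) → 1 ≤ n → (π : Permutation′ n) → (j k ℓ : ℕ) →
    1 < j → j ≤ k → k < ℓ → ℓ ≤ suc n →
    ∣ + b n (seq π · blockInterchange 1 j k ℓ) - + b n (seq π) ∣ ≤ 3
lemma5p2 n _ π (suc a) k ℓ _ j≤k k<ℓ ℓ≤n+1 with m≤n⇒∃[o]m+o≡n j≤k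
... | b′ , refl with m≤n⇒∃[o]m+o≡n (<⇒≤ k<ℓ)
... | c , refl with m≤n⇒∃[o]m+o≡n ℓ≤n+1
... | d , refl = near⇒∣-∣≤ (PrefixInterchange.breakpoint-bound a b′ c d (seq π))
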